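{- Let $G$ and $H$ be finite simple graphs. Suppose that $H$ is not well-covered and $G$ has an isolatable vertex. Then the Cartesian product $G\,\square\, H$ is not well-covered.
   Context: A graph is well-covered if every maximal independent set of vertices has the same cardinality. A vertex $x$ of $G$ is isolatable if there is an independent set $M$ of $G$ such that $G-N[M]$ consists of the single vertex $x$, where $N[M]$ is the closed neighborhood of $M$. The Cartesian product $G\,\square\, H$ has vertex set $V(G)\times V(H)$, with $(x_1,x_2)$ adjacent to $(y_1,y_2)$ if either $x_1=y_1$ and $x_2y_2\in E(H)$, or $x_1y_1\in E(G)$ and $x_2=y_2$. -}

module Defs where

open import Data.Nat using (ℕ; _*_)
open import Data.Fin using (Fin; remQuot)
open import Data.Fin.Subset using (Subset; _∈_; _∉_; ∣_∣)
open import Data.Product using (_×_; _,_; proj₁; proj₂; ∃)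
open import Data.Sum using (_⊎_)
open import Relation.Nullary using (¬_; Dec)
open import Relation.Binary.PropositionalEquality using (_≡_)

record Graph (n : ℕ) : Set₁ where
  field
    Adj      : Fin n → Fin n → Set
    adj?     : ∀ x y → Dec (Adj x y)
    irrefl   : ∀ x → ¬ Adj x x
    sym      : ∀ x y → Adj x y → Adj y x
open Graph public

module _ {n : ℕ} (G : Graph n) where

  Independent : Subset n → Set
  Independent S = ∀ x y → x ∈ S → y ∈ S → ¬ Adj G x y

  MaximalIndependent : Subset n → Set
  MaximalIndependent S =
    Independent S × (∀ T → Independent T → (∀ x → x ∈ S → x ∈ T) → ∀ x → x ∈ T → x ∈ S)

  WellCovered : Set
  WellCovered = ∀ S T → MaximalIndependent S → MaximalIndependent T → ∣ S ∣ ≡ ∣ T ∣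

  InClosedNbhd : Subset n → Fin n → Set
  InClosedNbhd M y = y ∈ M ⊎ ∃ λ z → z ∈ M × Adj G z y

  Isolatable : Fin n → Set
  Isolatable x = ∃ λ M → Independent M ×
    (¬ InClosedNbhd M x) × (∀ y → ¬ InClosedNbhd M y → y ≡ x)

-- Cartesian product G □ H on Fin (n * m), vertices encoded via remQuot
-- (the bijection Fin (n * m) ≃ Fin n × Fin m).
_□_ : ∀ {n m} → Graph n → Graph m → Graph (n * m)
_□_ {n} {m} G H = record
  { Adj = λ u v → AdjP (remQuot m u) (remQuot m v)
  ; adj? = λ u v → adjP? (remQuot m u) (remQuot m v)
  ; irrefl = λ u → irrP (remQuot m u)
  ; sym = λ u v → symP (remQuot m u) (remQuot m v)
  }
  where
  open import Relation.Nullary using (yes; no)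
  open import Data.Sum using (inj₁; inj₂)
  open import Data.Fin using (_≟_)
  open import Relation.Binary.PropositionalEquality using (refl)
  import Relation.Binary.PropositionalEquality as Eq
  open import Relation.Nullary.Decidable using (_×-dec_; _⊎-dec_)

  AdjP : Fin n × Fin m → Fin n × Fin m → Set
  AdjP (x₁ , x₂) (y₁ , y₂) = (x₁ ≡ y₁ × Adj H x₂ y₂) ⊎ (Adj G x₁ y₁ × x₂ ≡ y₂)

  adjP? : ∀ p q → Dec (AdjP p q)
  adjP? (x₁ , x₂) (y₁ , y₂) =
    ((x₁ ≟ y₁) ×-dec adj? H x₂ y₂) ⊎-dec (adj? G x₁ y₁ ×-dec (x₂ ≟ y₂))

  irrP : ∀ p → ¬ AdjP p p
  irrP (x₁ , x₂) (inj₁ (_ , a)) = irrefl H x₂ a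
  irrP (x₁ , x₂) (inj₂ (a , _)) = irrefl G x₁ a

  symP : ∀ p q → AdjP p q → AdjP q p
  symP (x₁ , x₂) (y₁ , y₂) (inj₁ (e , a)) = inj₁ (Eq.sym e , sym H x₂ y₂ a)
  symP (x₁ , x₂) (y₁ , y₂) (inj₂ (a , e)) = inj₂ (sym G x₁ y₁ a , Eq.sym e)

module Submission where

-- Let M be independent in G with G − N[M] = {x}, and let
-- S, T be maximal independent sets of H.  Extend (M × T) ∪ ({x} × S) to a
-- maximal independent set L of G □ H; its x-layer is exactly S.  No cell
-- (y , h) of L has y ∼ x and h ∈ T, since y ∈ N[M] ∖ M has a neighbour z ∈ M
-- and (z , h) ∈ L.  So replacing the x-layer of L by T yields an independent
-- set L′ with ∣L′∣ + ∣S∣ = ∣L∣ + ∣T∣.  If G □ H were well-covered, ∣L′∣ ≤ ∣L∣,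
-- hence ∣T∣ ≤ ∣S∣; by symmetry ∣S∣ = ∣T∣ and H would be well-covered.

open import Defs hiding (sym)
open import Data.Nat using (ℕ; zero; suc; _+_; _*_; _≤_; _<_)
open import Data.Nat.Properties as ℕ using (+-0-commutativeMonoid)
open import Data.Fin using (Fin; zero; suc; _↑ˡ_; _↑ʳ_; combine; remQuot; punchIn; _≟_)
open import Data.Fin.Properties using (remQuot-combine; combine-remQuot; punchInᵢ≢i; all?; any?; ¬∀⟶∃¬)
open import Data.Fin.Subset using (Subset; _∈_; _⊆_; ∣_∣; _∪_; ⁅_⁆)
open import Data.Fin.Subset.Properties
  using (_∈?_; x∈p∪q⁻; x∈p∪q⁺; x∈⁅y⁆⇒x≡y; x∈⁅x⁆; p⊆p∪q; ∈⊤; p⊆q⇒∣p∣≤∣q∣; p⊂q⇒∣p∣<∣q∣; ∣p∣≤n; ∣p∣≡n⇒p≡⊤)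
open import Data.Vec using ([]; _∷_; lookup; tabulate)
open import Data.Vec.Properties using ([]=⇒lookup; lookup⇒[]=; lookup∘tabulate)
open import Data.Bool using (Bool; true; false)
open import Data.Bool.Properties using (T-≡)
open import Data.Product using (Σ; ∃; _×_; _,_; proj₁; proj₂)
open import Data.Sum using (_⊎_; inj₁; inj₂)
open import Data.Empty using (⊥-elim)
open import Function using (_∘_; id; _⇔_; mk⇔; Equivalence)
open import Relation.Nullary using (¬_; Dec; yes; no; ¬?)
open import Relation.Nullary.Decidable using (⌊_⌋; _×-dec_; _⊎-dec_; toWitness; fromWitness)
open import Relation.Binary.PropositionalEquality
  using (_≡_; _≢_; refl; sym; trans; cong; cong₂; subst; subst₂; module ≡-Reasoning)
open import Algebra.Properties.CommutativeMonoid.Sum +-0-commutativeMonoid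
  using (sum; sum-cong-≗; sum-remove)

open Equivalence using (to; from)

select : ∀ {k} {P : Fin k → Set} → (∀ i → Dec (P i)) → Subset k
select P? = tabulate (λ i → ⌊ P? i ⌋)

∈-select : ∀ {k} {P : Fin k → Set} (P? : ∀ i → Dec (P i)) i → i ∈ select P? ⇔ P i
∈-select P? i = mk⇔
  (λ i∈ → toWitness (T-≡ .from (trans (sym (lookup∘tabulate _ i)) ([]=⇒lookup i∈))))
  (λ Pi → lookup⇒[]= i _ (trans (lookup∘tabulate _ i) (T-≡ .to (fromWitness Pi))))

indicator : Bool → ℕ
indicator true  = 1
indicator false = 0

χ : ∀ {k} → Subset k → Fin k → ℕ
χ p i = indicator (lookup p i)

∣p∣≡∑χ : ∀ {k} (p : Subset k) → ∣ p ∣ ≡ sum (χ p)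
∣p∣≡∑χ []          = refl
∣p∣≡∑χ (true ∷ p)  = cong suc (∣p∣≡∑χ p)
∣p∣≡∑χ (false ∷ p) = ∣p∣≡∑χ p

χ-cong : ∀ {k l} (p : Subset k) (q : Subset l) i j → (i ∈ p ⇔ j ∈ q) → χ p i ≡ χ q j
χ-cong p q i j i⇔j with lookup p i in eᵢ | lookup q j in eⱼ
... | true  | true  = refl
... | false | false = refl
... | true  | false with () ← trans (sym ([]=⇒lookup (i⇔j .to (lookup⇒[]= i p eᵢ)))) eⱼ
... | false | true  with () ← trans (sym ([]=⇒lookup (i⇔j .from (lookup⇒[]= j q eⱼ)))) eᵢ

sum-↑ : ∀ a {b} (f : Fin (a + b) → ℕ) → sum f ≡ sum (f ∘ (_↑ˡ b)) + sum (f ∘ (a ↑ʳ_))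
sum-↑ zero    f = refl
sum-↑ (suc a) f = trans (cong (f zero +_) (sum-↑ a (f ∘ suc))) (sym (ℕ.+-assoc (f zero) _ _))

sum-combine : ∀ n m (f : Fin (n * m) → ℕ) →
  sum f ≡ sum {n} (λ g → sum {m} (λ h → f (combine g h)))
sum-combine zero    m f = refl
sum-combine (suc n) m f =
  trans (sum-↑ m f) (cong (sum (f ∘ (_↑ˡ (n * m))) +_) (sum-combine n m (f ∘ (m ↑ʳ_))))

sum-exchange : ∀ {k} (a b : Fin k → ℕ) x → (∀ i → i ≢ x → a i ≡ b i) → sum a + b x ≡ sum b + a x
sum-exchange {suc k} a b x agree = begin
  sum a + b x                      ≡⟨ cong (_+ b x) (sum-remove {i = x} a) ⟩
  a x + sum (a ∘ punchIn x) + b x  ≡⟨ cong (λ s → a x + s + b x) rest ⟩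
  a x + R + b x                    ≡⟨ ℕ.+-comm (a x + R) (b x) ⟩
  b x + (a x + R)                  ≡⟨ cong (b x +_) (ℕ.+-comm (a x) R) ⟩
  b x + (R + a x)                  ≡⟨ sym (ℕ.+-assoc (b x) R (a x)) ⟩
  b x + R + a x                    ≡⟨ cong (_+ a x) (sym (sum-remove {i = x} b)) ⟩
  sum b + a x                      ∎
  where
  open ≡-Reasoning
  R : ℕ
  R = sum (b ∘ punchIn x)
  rest : sum (a ∘ punchIn x) ≡ R
  rest = sum-cong-≗ (λ j → agree (punchIn x j) (punchInᵢ≢i x j))

module _ {N : ℕ} (K : Graph N) where

  Dominated : Subset N → Fin N → Set
  Dominated p v = v ∈ p ⊎ ∃ λ w → w ∈ p × Adj K v w

  dominated? : ∀ p v → Dec (Dominated p v)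
  dominated? p v = (v ∈? p) ⊎-dec any? (λ w → (w ∈? p) ×-dec adj? K v w)

  independent-∪⁅⁆ : ∀ {p v} → Independent K p → (∀ w → w ∈ p → ¬ Adj K v w) →
    Independent K (p ∪ ⁅ v ⁆)
  independent-∪⁅⁆ {p} {v} ind v≁p a b a∈ b∈ with x∈p∪q⁻ p ⁅ v ⁆ a∈ | x∈p∪q⁻ p ⁅ v ⁆ b∈
  ... | inj₁ a∈p | inj₁ b∈p = ind a b a∈p b∈p
  ... | inj₁ a∈p | inj₂ b∈v with refl ← x∈⁅y⁆⇒x≡y v b∈v = v≁p a a∈p ∘ Graph.sym K a v
  ... | inj₂ a∈v | inj₁ b∈p with refl ← x∈⁅y⁆⇒x≡y v a∈v = v≁p b b∈p
  ... | inj₂ a∈v | inj₂ b∈v with refl ← x∈⁅y⁆⇒x≡y v a∈v | refl ← x∈⁅y⁆⇒x≡y v b∈v = irrefl K v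

  dominating⇒maximal : ∀ {p} → Independent K p → (∀ v → Dominated p v) → MaximalIndependent K p
  dominating⇒maximal {p} ind dom = ind , maximal
    where
    maximal : ∀ T → Independent K T → (∀ x → x ∈ p → x ∈ T) → ∀ x → x ∈ T → x ∈ p
    maximal T indT p⊆T t t∈T with dom t
    ... | inj₁ t∈p              = t∈p
    ... | inj₂ (w , w∈p , t∼w) = ⊥-elim (indT t w t∈T (p⊆T w w∈p) t∼w)

  Extension : Subset N → Set
  Extension p = Σ (Subset N) λ q → MaximalIndependent K q × p ⊆ q

  -- Every independent set extends to a maximal one: add undominated vertices
  -- one at a time; the fuel k bounds how many can still be added.
  extend-within : ∀ k p → Independent K p → N ≤ k + ∣ p ∣ → Extension p
  extend-within k p ind bound with all? (dominated? p)
  ... | yes dom = p , dominating⇒maximal ind dom , id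
  ... | no ¬dom = grow k bound (¬∀⟶∃¬ N _ (dominated? p) ¬dom)
    where
    -- Without fuel p is all of Fin N, so no vertex is undominated.
    grow : ∀ k → N ≤ k + ∣ p ∣ → ∃ (λ v → ¬ Dominated p v) → Extension p
    grow zero bound (v , ¬dom-v) =
      ⊥-elim (¬dom-v (inj₁ (subst (v ∈_) (sym (∣p∣≡n⇒p≡⊤ (ℕ.≤-antisym (∣p∣≤n p) bound))) ∈⊤)))
    grow (suc k) bound (v , ¬dom-v) with extend-within k (p ∪ ⁅ v ⁆) ind′ bound′
      where
      ind′ : Independent K (p ∪ ⁅ v ⁆)
      ind′ = independent-∪⁅⁆ ind (λ w w∈p v∼w → ¬dom-v (inj₂ (w , w∈p , v∼w)))
      larger : ∣ p ∣ < ∣ p ∪ ⁅ v ⁆ ∣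
      larger = p⊂q⇒∣p∣<∣q∣ (p⊆p∪q ⁅ v ⁆ , v , x∈p∪q⁺ (inj₂ (x∈⁅x⁆ v)) , ¬dom-v ∘ inj₁)
      bound′ : N ≤ k + ∣ p ∪ ⁅ v ⁆ ∣
      bound′ = ℕ.≤-trans bound (subst (_≤ k + ∣ p ∪ ⁅ v ⁆ ∣) (ℕ.+-suc k ∣ p ∣) (ℕ.+-monoʳ-≤ k larger))
    ... | q , max-q , p∪v⊆q = q , max-q , p∪v⊆q ∘ p⊆p∪q ⁅ v ⁆

  extend : ∀ p → Independent K p → Extension p
  extend p ind = extend-within N p ind (ℕ.m≤m+n N ∣ p ∣)

  wellCovered⇒independent≤maximal : WellCovered K → ∀ {p q} →
    Independent K p → MaximalIndependent K q → ∣ p ∣ ≤ ∣ q ∣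
  wellCovered⇒independent≤maximal wc {p} {q} ind max-q with extend p ind
  ... | r , max-r , p⊆r = subst (∣ p ∣ ≤_) (wc r q max-r max-q) (p⊆q⇒∣p∣≤∣q∣ p⊆r)

-- The Cartesian product G □ H, viewed through coordinates: the vertex
-- combine g h of Fin (n * m) is the cell (g , h), and adjacency of cells is
-- "same g and H-adjacent, or G-adjacent and same h".

module Cells {n m : ℕ} (G : Graph n) (H : Graph m) where

  Cell : Set
  Cell = Fin n × Fin m

  cell : Cell → Fin (n * m)
  cell (g , h) = combine g h

  _∈□_ : Cell → Subset (n * m) → Set
  c ∈□ L = cell c ∈ L

  Adj□ : Cell → Cell → Set
  Adj□ (g , h) (g′ , h′) = (g ≡ g′ × Adj H h h′) ⊎ (Adj G g g′ × h ≡ h′)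

  Adj□-sym : ∀ c d → Adj□ c d → Adj□ d c
  Adj□-sym c d (inj₁ (e , a)) = inj₁ (sym e , Graph.sym H _ _ a)
  Adj□-sym c d (inj₂ (a , e)) = inj₂ (Graph.sym G _ _ a , sym e)

  CellIndependent : Subset (n * m) → Set
  CellIndependent L = ∀ c d → c ∈□ L → d ∈□ L → ¬ Adj□ c d

  independent⇒cellIndependent : ∀ {L} → Independent (G □ H) L → CellIndependent L
  independent⇒cellIndependent ind c d c∈ d∈ c∼d =
    ind (cell c) (cell d) c∈ d∈ (subst₂ Adj□ (sym (remQuot-combine _ _)) (sym (remQuot-combine _ _)) c∼d)

  cellIndependent⇒independent : ∀ {L} → CellIndependent L → Independent (G □ H) L
  cellIndependent⇒independent {L} ind u v u∈ v∈ =
    ind (remQuot m u) (remQuot m v) (∈-cell u u∈) (∈-cell v v∈)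
    where
    ∈-cell : ∀ w → w ∈ L → remQuot m w ∈□ L
    ∈-cell w = subst (_∈ L) (sym (combine-remQuot {n} m w))

  select□ : {P : Cell → Set} → (∀ c → Dec (P c)) → Subset (n * m)
  select□ P? = select (P? ∘ remQuot m)

  ∈-select□ : {P : Cell → Set} (P? : ∀ c → Dec (P c)) → ∀ c → c ∈□ select□ P? ⇔ P c
  ∈-select□ {P} P? c = mk⇔
    (λ c∈ → subst P (remQuot-combine _ _) (∈-select (P? ∘ remQuot m) (cell c) .to c∈))
    (λ Pc → ∈-select (P? ∘ remQuot m) (cell c) .from (subst P (sym (remQuot-combine _ _)) Pc))

  layer-exchange : ∀ (L L′ : Subset (n * m)) x (A B : Subset m) →
    (∀ g h → g ≢ x → (g , h) ∈□ L ⇔ (g , h) ∈□ L′) →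
    (∀ h → (x , h) ∈□ L ⇔ h ∈ A) → (∀ h → (x , h) ∈□ L′ ⇔ h ∈ B) →
    ∣ L ∣ + ∣ B ∣ ≡ ∣ L′ ∣ + ∣ A ∣
  layer-exchange L L′ x A B outside layerA layerB = begin
    ∣ L ∣ + ∣ B ∣                        ≡⟨ cong₂ _+_ (size L) (layer L′ B layerB) ⟩
    sum (layerSize L) + layerSize L′ x  ≡⟨ sum-exchange (layerSize L) (layerSize L′) x same ⟩
    sum (layerSize L′) + layerSize L x  ≡⟨ sym (cong₂ _+_ (size L′) (layer L A layerA)) ⟩
    ∣ L′ ∣ + ∣ A ∣                       ∎
    where
    open ≡-Reasoning
    layerSize : Subset (n * m) → Fin n → ℕ
    layerSize L g = sum (λ h → χ L (cell (g , h)))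
    size : ∀ L → ∣ L ∣ ≡ sum (layerSize L)
    size L = trans (∣p∣≡∑χ L) (sum-combine n m (χ L))
    layer : ∀ L C → (∀ h → (x , h) ∈□ L ⇔ h ∈ C) → ∣ C ∣ ≡ layerSize L x
    layer L C iff = trans (∣p∣≡∑χ C) (sum-cong-≗ (λ h → sym (χ-cong L C _ h (iff h))))
    same : ∀ g → g ≢ x → layerSize L g ≡ layerSize L′ g
    same g g≢x = sum-cong-≗ (λ h → χ-cong L L′ _ _ (outside g h g≢x))

module LayerExchange {n m : ℕ} (G : Graph n) (H : Graph m)
  {x : Fin n} {M : Subset n} (M-indep : Independent G M)
  (x∉N[M] : ¬ InClosedNbhd G M x) (only-x : ∀ y → ¬ InClosedNbhd G M y → y ≡ x)
  {S T : Subset m} (S-max : MaximalIndependent H S) (T-max : MaximalIndependent H T) where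

  open Cells G H

  M-avoids-x : ∀ {g} → g ∈ M → g ≢ x
  M-avoids-x g∈M refl = x∉N[M] (inj₁ g∈M)

  M-not-next-to-x : ∀ {g} → g ∈ M → ¬ Adj G g x
  M-not-next-to-x g∈M g∼x = x∉N[M] (inj₂ (_ , g∈M , g∼x))

  -- Every G-neighbour of x lies in N[M], since only x is left outside.
  neighbour-of-x-dominated : ∀ {y} → Adj G x y → ¬ ¬ InClosedNbhd G M y
  neighbour-of-x-dominated {y} x∼y y∉N[M] with refl ← only-x y y∉N[M] = irrefl G x x∼y

  Seed : Cell → Set
  Seed (g , h) = (g ∈ M × h ∈ T) ⊎ (g ≡ x × h ∈ S)

  seed? : ∀ c → Dec (Seed c)
  seed? (g , h) = ((g ∈? M) ×-dec (h ∈? T)) ⊎-dec ((g ≟ x) ×-dec (h ∈? S))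

  M×T≁x×H : ∀ g h h′ → g ∈ M → ¬ Adj□ (g , h) (x , h′)
  M×T≁x×H g h h′ g∈M (inj₁ (g≡x , _)) = M-avoids-x g∈M g≡x
  M×T≁x×H g h h′ g∈M (inj₂ (g∼x , _)) = M-not-next-to-x g∈M g∼x

  seed-independent : ∀ c d → Seed c → Seed d → ¬ Adj□ c d
  seed-independent _ _ (inj₁ (_ , h∈T)) (inj₁ (_ , h′∈T)) (inj₁ (_ , h∼h′)) = T-max .proj₁ _ _ h∈T h′∈T h∼h′
  seed-independent _ _ (inj₁ (g∈M , _)) (inj₁ (g′∈M , _)) (inj₂ (g∼g′ , _)) = M-indep _ _ g∈M g′∈M g∼g′
  seed-independent _ _ (inj₂ (_ , h∈S)) (inj₂ (_ , h′∈S)) (inj₁ (_ , h∼h′)) = S-max .proj₁ _ _ h∈S h′∈S h∼h′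
  seed-independent (g , _) (g′ , _) (inj₂ (refl , _)) (inj₂ (refl , _)) (inj₂ (x∼x , _)) = irrefl G x x∼x
  seed-independent (g , h) (g′ , h′) (inj₁ (g∈M , _)) (inj₂ (refl , _)) = M×T≁x×H g h h′ g∈M
  seed-independent (g , h) (g′ , h′) (inj₂ (refl , _)) (inj₁ (g′∈M , _)) =
    M×T≁x×H g′ h′ h g′∈M ∘ Adj□-sym (x , h) (g′ , h′)

  L-extension : Extension (G □ H) (select□ seed?)
  L-extension = extend (G □ H) (select□ seed?) (cellIndependent⇒independent λ c d c∈ d∈ →
    seed-independent c d (∈-select□ seed? c .to c∈) (∈-select□ seed? d .to d∈))

  L : Subset (n * m)
  L = proj₁ L-extension

  L-max : MaximalIndependent (G □ H) L
  L-max = proj₁ (proj₂ L-extension)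

  L-indep : CellIndependent L
  L-indep = independent⇒cellIndependent (proj₁ L-max)

  seed⊆L : ∀ c → Seed c → c ∈□ L
  seed⊆L c Sc = proj₂ (proj₂ L-extension) (∈-select□ seed? c .from Sc)

  -- The x-layer of L is exactly S: any h there is non-adjacent to all of S.
  L-layer-x : ∀ h → (x , h) ∈□ L ⇔ h ∈ S
  L-layer-x h = mk⇔ in-S (λ h∈S → seed⊆L (x , h) (inj₂ (refl , h∈S)))
    where
    in-S : (x , h) ∈□ L → h ∈ S
    in-S xh∈L = S-max .proj₂ (S ∪ ⁅ h ⁆) (independent-∪⁅⁆ H (S-max .proj₁) h≁S)
      (λ _ → p⊆p∪q ⁅ h ⁆) h (x∈p∪q⁺ (inj₂ (x∈⁅x⁆ h)))
      where
      h≁S : ∀ s → s ∈ S → ¬ Adj H h s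
      h≁S s s∈S h∼s = L-indep (x , h) (x , s) xh∈L (seed⊆L (x , s) (inj₂ (refl , s∈S))) (inj₁ (refl , h∼s))

  -- No cell (y , h) of L has y ∼ x and h ∈ T: y is dominated but not in M,
  -- so some z ∈ M is adjacent to y, and (z , h) ∈ M × T ⊆ L is adjacent to (y , h).
  L-avoids-T-next-to-x : ∀ y h → Adj G x y → h ∈ T → ¬ (y , h) ∈□ L
  L-avoids-T-next-to-x y h x∼y h∈T yh∈L = neighbour-of-x-dominated x∼y λ where
    (inj₁ y∈M)               → M-not-next-to-x y∈M (Graph.sym G x y x∼y)
    (inj₂ (z , z∈M , z∼y)) →
      L-indep (z , h) (y , h) (seed⊆L (z , h) (inj₁ (z∈M , h∈T))) yh∈L (inj₂ (z∼y , refl))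

  Swapped : Cell → Set
  Swapped (g , h) = (g ≡ x × h ∈ T) ⊎ (g ≢ x × (g , h) ∈□ L)

  swapped? : ∀ c → Dec (Swapped c)
  swapped? (g , h) = ((g ≟ x) ×-dec (h ∈? T)) ⊎-dec (¬? (g ≟ x) ×-dec (cell (g , h) ∈? L))

  x×T≁L : ∀ h g′ h′ → h ∈ T → g′ ≢ x → (g′ , h′) ∈□ L → ¬ Adj□ (x , h) (g′ , h′)
  x×T≁L h g′ h′ h∈T g′≢x d∈L (inj₁ (x≡g′ , _))   = g′≢x (sym x≡g′)
  x×T≁L h g′ h′ h∈T g′≢x d∈L (inj₂ (x∼g′ , refl)) = L-avoids-T-next-to-x g′ h x∼g′ h∈T d∈L

  swapped-independent : ∀ c d → Swapped c → Swapped d → ¬ Adj□ c d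
  swapped-independent _ _ (inj₁ (_ , h∈T)) (inj₁ (_ , h′∈T)) (inj₁ (_ , h∼h′)) = T-max .proj₁ _ _ h∈T h′∈T h∼h′
  swapped-independent (g , _) (g′ , _) (inj₁ (refl , _)) (inj₁ (refl , _)) (inj₂ (x∼x , _)) = irrefl G x x∼x
  swapped-independent c d (inj₂ (_ , c∈L)) (inj₂ (_ , d∈L)) = L-indep c d c∈L d∈L
  swapped-independent (g , h) (g′ , h′) (inj₁ (refl , h∈T)) (inj₂ (g′≢x , d∈L)) = x×T≁L h g′ h′ h∈T g′≢x d∈L
  swapped-independent (g , h) (g′ , h′) (inj₂ (g≢x , c∈L)) (inj₁ (refl , h′∈T)) =
    x×T≁L h′ g h h′∈T g≢x c∈L ∘ Adj□-sym (g , h) (x , h′)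

  L′ : Subset (n * m)
  L′ = select□ swapped?

  L′-indep : Independent (G □ H) L′
  L′-indep = cellIndependent⇒independent λ c d c∈ d∈ →
    swapped-independent c d (∈-select□ swapped? c .to c∈) (∈-select□ swapped? d .to d∈)

  exchange-count : ∣ L′ ∣ + ∣ S ∣ ≡ ∣ L ∣ + ∣ T ∣
  exchange-count = layer-exchange L′ L x T S outside L′-layer-x L-layer-x
    where
    outside : ∀ g h → g ≢ x → (g , h) ∈□ L′ ⇔ (g , h) ∈□ L
    outside g h g≢x = mk⇔
      (λ c∈ → case (∈-select□ swapped? (g , h) .to c∈))
      (λ c∈L → ∈-select□ swapped? (g , h) .from (inj₂ (g≢x , c∈L)))
      where
      case : Swapped (g , h) → (g , h) ∈□ L
      case (inj₁ (g≡x , _)) = ⊥-elim (g≢x g≡x)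
      case (inj₂ (_ , c∈L)) = c∈L
    L′-layer-x : ∀ h → (x , h) ∈□ L′ ⇔ h ∈ T
    L′-layer-x h = mk⇔
      (λ c∈ → case (∈-select□ swapped? (x , h) .to c∈))
      (λ h∈T → ∈-select□ swapped? (x , h) .from (inj₁ (refl , h∈T)))
      where
      case : Swapped (x , h) → h ∈ T
      case (inj₁ (_ , h∈T)) = h∈T
      case (inj₂ (x≢x , _)) = ⊥-elim (x≢x refl)

  -- If G □ H is well-covered, L′ is no larger than L, so ∣ T ∣ ≤ ∣ S ∣.
  wellCovered⇒∣T∣≤∣S∣ : WellCovered (G □ H) → ∣ T ∣ ≤ ∣ S ∣
  wellCovered⇒∣T∣≤∣S∣ wc = ℕ.+-cancelˡ-≤ ∣ L ∣ _ _ (begin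
    ∣ L ∣ + ∣ T ∣    ≡⟨ sym exchange-count ⟩
    ∣ L′ ∣ + ∣ S ∣   ≤⟨ ℕ.+-monoˡ-≤ ∣ S ∣ (wellCovered⇒independent≤maximal (G □ H) wc L′-indep L-max) ⟩
    ∣ L ∣ + ∣ S ∣    ∎)
    where open ℕ.≤-Reasoning

theorem4 : {n m : ℕ} (G : Graph n) (H : Graph m) →
    ¬ WellCovered H → ∃ (λ x → Isolatable G x) → ¬ WellCovered (G □ H)
theorem4 G H ¬wc-H (x , M , M-indep , x∉N[M] , only-x) wc-G□H = ¬wc-H λ S T S-max T-max →
  ℕ.≤-antisym (∣T∣≤∣S∣ T-max S-max) (∣T∣≤∣S∣ S-max T-max)
  where
  ∣T∣≤∣S∣ : ∀ {S T} → MaximalIndependent H S → MaximalIndependent H T → ∣ T ∣ ≤ ∣ S ∣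
  ∣T∣≤∣S∣ S-max T-max =
    LayerExchange.wellCovered⇒∣T∣≤∣S∣ G H M-indep x∉N[M] only-x S-max T-max wc-G□H
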